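{- Let $n$ be an odd positive integer and $a$ a positive integer, and suppose $x = n^2 + a$ or $x = n^2 - a$ is a Hall number with $x > 10^{18}$. Then $a > \sqrt{n}$.
   Context: For a positive integer $x$ that is not a perfect square, let $k_x$ denote the distance between $x^3$ and the perfect square closest to $x^3$, and $r_x = \sqrt{x}/k_x$; a Hall number is a non-square positive integer $x$ with $r_x > 1$. -}

module Defs where

open import Data.Nat using (ℕ; _*_; _^_; _<_; _≤_; ∣_-_∣)
open import Data.Product using (Σ; _×_; ∃)
open import Relation.Binary.PropositionalEquality using (_≡_)
open import Relation.Nullary using (¬_)

IsSquare : ℕ → Set
IsSquare x = ∃ λ m → m * m ≡ x

NearestSquareDist : ℕ → ℕ → Set
NearestSquareDist x k =
  (∃ λ m → ∣ x ^ 3 - m * m ∣ ≡ k) × (∀ m → k ≤ ∣ x ^ 3 - m * m ∣)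

-- Hall number: non-square positive x with r_x = sqrt x / k_x > 1,
-- i.e. (k_x > 0 since x^3 is not a square) k_x < sqrt x, i.e. k_x * k_x < x.
Hall : ℕ → Set
Hall x = (0 < x) × (¬ IsSquare x) × (∃ λ k → NearestSquareDist x k × (k * k < x))

{-# OPTIONS --safe #-}
module Submission where

-- If a² ≤ n then x ≤ n² + n, so the Hall condition k_x² < x forces x³ to lie within n of a
-- square, i.e. 4x³ lies within 4n of a square.  But 4x³ = P² + E with P = 2n³ ± 3an and
-- E = 3a²n² ± 4a³, and for n ≥ 7 we have 4n < E ≤ 2P − 4n, so 4x³ sits in the gap between
-- P² and (P + 1)² at distance more than 4n from both.  The bound
-- x > 10¹⁸ is only used to get n ≥ 7.

open import Defs
open import Data.Nat using (ℕ; suc; _+_; _*_; _^_; _<_; _%_; _≤_; _∸_; _≤?_; ∣_-_∣; z<s; s≤s)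
open import Data.Nat.Properties
open import Data.Nat.Tactic.RingSolver using (solve-∀)
open import Data.Product using (∃; _,_)
open import Data.Sum using (_⊎_; inj₁; inj₂)
open import Relation.Nullary using (¬_; yes; no; contradiction)
open import Relation.Binary.PropositionalEquality using (_≡_; refl; sym; trans; cong; subst; module ≡-Reasoning)

NearSquare : ℕ → ℕ → Set
NearSquare N d = ∃ λ q → ∣ N - q * q ∣ ≤ d

NearSquare-scale : ∀ c {N d} → NearSquare N d → NearSquare (c * c * N) (c * c * d)
NearSquare-scale c {N} {d} (q , near) = c * q , (begin
  ∣ c * c * N - c * q * (c * q) ∣ ≡⟨ cong (λ s → ∣ c * c * N - s ∣) (square-distrib c q) ⟩
  ∣ c * c * N - c * c * (q * q) ∣ ≡⟨ *-distribˡ-∣-∣ (c * c) N (q * q) ⟨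
  c * c * ∣ N - q * q ∣           ≤⟨ *-monoʳ-≤ (c * c) near ⟩
  c * c * d                       ∎)
  where
  open ≤-Reasoning
  square-distrib : ∀ c q → c * q * (c * q) ≡ c * c * (q * q)
  square-distrib = solve-∀

suc-square : ∀ m → suc m * suc m ≡ suc (m * m + 2 * m)
suc-square = solve-∀

gap⇒¬NearSquare : ∀ P {d N} → P * P + d < N → N + d ≤ P * P + 2 * P → ¬ NearSquare N d
gap⇒¬NearSquare P {d} {N} below above (q , near) with q ≤? P
... | yes q≤P = <⇒≱ below (begin
  N                     ≤⟨ m≤n+∣m-n∣ N (q * q) ⟩
  q * q + ∣ N - q * q ∣ ≤⟨ +-mono-≤ (*-mono-≤ q≤P q≤P) near ⟩
  P * P + d             ∎)
  where open ≤-Reasoning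
... | no q≰P = <⇒≱ (begin-strict
  N + d               ≤⟨ above ⟩
  P * P + 2 * P       <⟨ n<1+n _ ⟩
  suc (P * P + 2 * P) ≡⟨ suc-square P ⟨
  suc P * suc P       ∎) (begin
  suc P * suc P       ≤⟨ *-mono-≤ (≰⇒> q≰P) (≰⇒> q≰P) ⟩
  q * q               ≤⟨ m≤n+∣n-m∣ (q * q) N ⟩
  N + ∣ N - q * q ∣   ≤⟨ +-monoʳ-≤ N near ⟩
  N + d               ∎)
  where open ≤-Reasoning

7≤n⇒8n<3n² : ∀ {n} → 7 ≤ n → 8 * n < 3 * (n * n)
7≤n⇒8n<3n² 7≤n with m≤n⇒∃[o]m+o≡n 7≤n
... | t , refl = subst (8 * (7 + t) <_) (sym (expand t)) (m<m+n _ z<s)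
  where
  expand : ∀ t → 3 * ((7 + t) * (7 + t)) ≡ 8 * (7 + t) + suc (90 + 34 * t + 3 * (t * t))
  expand = solve-∀

7≤n⇒6n²+4n≤n³ : ∀ {n} → 7 ≤ n → 6 * (n * n) + 4 * n ≤ n * n * n
7≤n⇒6n²+4n≤n³ 7≤n with m≤n⇒∃[o]m+o≡n 7≤n
... | t , refl = subst (6 * ((7 + t) * (7 + t)) + 4 * (7 + t) ≤_) (sym (expand t)) (m≤m+n _ _)
  where
  expand : ∀ t → (7 + t) * (7 + t) * (7 + t)
               ≡ 6 * ((7 + t) * (7 + t)) + 4 * (7 + t) + (21 + 59 * t + 15 * (t * t) + t * t * t)
  expand = solve-∀

0<a⇒n≤a*n : ∀ {a} n → 0 < a → n ≤ a * n
0<a⇒n≤a*n {a} n 0<a = subst (_≤ a * n) (*-identityˡ n) (*-monoˡ-≤ n 0<a)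

module _ {n a : ℕ} (0<a : 0 < a) (a²≤n : a * a ≤ n) where

  a≤n : a ≤ n
  a≤n = ≤-trans (subst (_≤ a * a) (*-identityʳ a) (*-monoʳ-≤ a 0<a)) a²≤n

  a*n≤n*n : a * n ≤ n * n
  a*n≤n*n = *-monoˡ-≤ n a≤n

  a³≤a*n : a * a * a ≤ a * n
  a³≤a*n = subst (_≤ a * n) (sym (*-assoc a a a)) (*-monoʳ-≤ a a²≤n)

  [a*n]²≤n³ : a * n * (a * n) ≤ n * n * n
  [a*n]²≤n³ = begin
    a * n * (a * n) ≡⟨ regroup a n ⟩
    a * a * (n * n) ≤⟨ *-monoˡ-≤ (n * n) a²≤n ⟩
    n * (n * n)     ≡⟨ *-assoc n n n ⟨
    n * n * n       ∎
    where
    open ≤-Reasoning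
    regroup : ∀ b m → b * m * (b * m) ≡ b * b * (m * m)
    regroup = solve-∀

4[n²+a]³-not-near-square : ∀ {n a x} → 7 ≤ n → 0 < a → a * a ≤ n →
  x ≡ n ^ 2 + a → ¬ NearSquare (4 * x ^ 3) (4 * n)
4[n²+a]³-not-near-square {n} {a} 7≤n 0<a a²≤n refl = gap⇒¬NearSquare P below above
  where
  open ≤-Reasoning
  c P E : ℕ
  c = a * n
  P = 2 * (n * n * n) + 3 * c
  E = 3 * (c * c) + 4 * (a * a * a)

  expand : 4 * (n ^ 2 + a) ^ 3 ≡ P * P + E
  expand = identity n a
    where
    -- The power is unfolded because the ring solver rejects powers of compound terms.
    identity : ∀ m b → 4 * ((m * (m * 1) + b) * ((m * (m * 1) + b) * ((m * (m * 1) + b) * 1)))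
      ≡ (2 * (m * m * m) + 3 * (b * m)) * (2 * (m * m * m) + 3 * (b * m))
        + (3 * (b * m * (b * m)) + 4 * (b * b * b))
    identity = solve-∀

  4n<E : 4 * n < E
  4n<E = begin-strict
    4 * n       ≤⟨ *-monoˡ-≤ n (m≤m+n 4 4) ⟩
    8 * n       <⟨ 7≤n⇒8n<3n² 7≤n ⟩
    3 * (n * n) ≤⟨ *-monoʳ-≤ 3 (*-mono-≤ (0<a⇒n≤a*n n 0<a) (0<a⇒n≤a*n n 0<a)) ⟩
    3 * (c * c) ≤⟨ m≤m+n _ _ ⟩
    E           ∎

  E+4n≤2P : E + 4 * n ≤ 2 * P
  E+4n≤2P = begin
    E + 4 * n
      ≤⟨ +-mono-≤ (+-mono-≤ (*-monoʳ-≤ 3 ([a*n]²≤n³ 0<a a²≤n)) (*-monoʳ-≤ 4 (a³≤a*n 0<a a²≤n)))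
                  (≤-trans (m≤n+m (4 * n) (6 * (n * n))) (7≤n⇒6n²+4n≤n³ 7≤n)) ⟩
    3 * (n * n * n) + 4 * c + n * n * n         ≤⟨ m≤m+n _ (2 * c) ⟩
    3 * (n * n * n) + 4 * c + n * n * n + 2 * c ≡⟨ regroup (n * n * n) c ⟩
    2 * P                                       ∎
    where
    regroup : ∀ m d → 3 * m + 4 * d + m + 2 * d ≡ 2 * (2 * m + 3 * d)
    regroup = solve-∀

  below : P * P + 4 * n < 4 * (n ^ 2 + a) ^ 3
  below = subst (P * P + 4 * n <_) (sym expand) (+-monoʳ-< (P * P) 4n<E)

  above : 4 * (n ^ 2 + a) ^ 3 + 4 * n ≤ P * P + 2 * P
  above = begin
    4 * (n ^ 2 + a) ^ 3 + 4 * n ≡⟨ cong (_+ 4 * n) expand ⟩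
    P * P + E + 4 * n           ≡⟨ +-assoc (P * P) E (4 * n) ⟩
    P * P + (E + 4 * n)         ≤⟨ +-monoʳ-≤ (P * P) E+4n≤2P ⟩
    P * P + 2 * P               ∎

-- x = n² − a cannot be substituted in ℕ; adding 6an(P + an) = 12axn² to both sides turns
-- each into a polynomial in x + a and P + 3an.
cube-difference-identity : ∀ {x a n P} → x + a ≡ n * n → P + 3 * (a * n) ≡ 2 * (n * n * n) →
  4 * x ^ 3 + 4 * (a * a * a) ≡ P * P + 3 * (a * n * (a * n))
cube-difference-identity {x} {a} {n} {P} x+a≡n² P+3an≡2n³ =
  +-cancelʳ-≡ (6 * (a * n) * (P + a * n)) _ _ (begin
    4 * x ^ 3 + 4 * (a * a * a) + 6 * (a * n) * (P + a * n)
      ≡⟨ cong (λ s → 4 * x ^ 3 + 4 * (a * a * a) + 6 * (a * n) * s) 2xn≡P+an ⟨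
    4 * x ^ 3 + 4 * (a * a * a) + 6 * (a * n) * (2 * (x * n))
      ≡⟨ regroup x a n ⟩
    4 * x ^ 3 + 4 * (a * a * a) + 12 * (a * x) * (n * n)
      ≡⟨ cong (λ s → 4 * x ^ 3 + 4 * (a * a * a) + 12 * (a * x) * s) x+a≡n² ⟨
    4 * x ^ 3 + 4 * (a * a * a) + 12 * (a * x) * (x + a)
      ≡⟨ cube-of-sum x a ⟩
    4 * ((x + a) * (x + a) * (x + a))
      ≡⟨ cong (λ s → 4 * (s * s * s)) x+a≡n² ⟩
    4 * (n * n * (n * n) * (n * n))
      ≡⟨ sixth-power n ⟩
    2 * (n * n * n) * (2 * (n * n * n))
      ≡⟨ cong (λ s → s * s) P+3an≡2n³ ⟨
    (P + 3 * (a * n)) * (P + 3 * (a * n))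
      ≡⟨ square-of-sum P (a * n) ⟩
    P * P + 3 * (a * n * (a * n)) + 6 * (a * n) * (P + a * n) ∎)
  where
  open ≡-Reasoning
  2xn≡P+an : 2 * (x * n) ≡ P + a * n
  2xn≡P+an = +-cancelʳ-≡ (2 * (a * n)) _ _ (begin
    2 * (x * n) + 2 * (a * n) ≡⟨ factor x a n ⟩
    2 * n * (x + a)           ≡⟨ cong (2 * n *_) x+a≡n² ⟩
    2 * n * (n * n)           ≡⟨ reassoc n ⟩
    2 * (n * n * n)           ≡⟨ P+3an≡2n³ ⟨
    P + 3 * (a * n)           ≡⟨ split P (a * n) ⟩
    P + a * n + 2 * (a * n)   ∎)
    where
    factor : ∀ y b m → 2 * (y * m) + 2 * (b * m) ≡ 2 * m * (y + b)
    factor = solve-∀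
    reassoc : ∀ m → 2 * m * (m * m) ≡ 2 * (m * m * m)
    reassoc = solve-∀
    split : ∀ Q d → Q + 3 * d ≡ Q + d + 2 * d
    split = solve-∀
  regroup : ∀ y b m → 4 * (y * (y * (y * 1))) + 4 * (b * b * b) + 6 * (b * m) * (2 * (y * m))
                    ≡ 4 * (y * (y * (y * 1))) + 4 * (b * b * b) + 12 * (b * y) * (m * m)
  regroup = solve-∀
  cube-of-sum : ∀ y b → 4 * (y * (y * (y * 1))) + 4 * (b * b * b) + 12 * (b * y) * (y + b)
                      ≡ 4 * ((y + b) * (y + b) * (y + b))
  cube-of-sum = solve-∀
  sixth-power : ∀ m → 4 * (m * m * (m * m) * (m * m)) ≡ 2 * (m * m * m) * (2 * (m * m * m))
  sixth-power = solve-∀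
  square-of-sum : ∀ Q d → (Q + 3 * d) * (Q + 3 * d) ≡ Q * Q + 3 * (d * d) + 6 * d * (Q + d)
  square-of-sum = solve-∀

4[n²-a]³-not-near-square : ∀ {n a x} → 7 ≤ n → 0 < a → a * a ≤ n →
  x + a ≡ n * n → ¬ NearSquare (4 * x ^ 3) (4 * n)
4[n²-a]³-not-near-square {n} {a} {x} 7≤n 0<a a²≤n x+a≡n² = gap⇒¬NearSquare P below above
  where
  c : ℕ
  c = a * n

  3c²+4n+6c≤4n³ : 3 * (c * c) + 4 * n + 2 * (3 * c) ≤ 2 * (2 * (n * n * n))
  3c²+4n+6c≤4n³ = begin
    3 * (c * c) + 4 * n + 2 * (3 * c)
      ≤⟨ +-mono-≤ (+-monoˡ-≤ (4 * n) (*-monoʳ-≤ 3 ([a*n]²≤n³ 0<a a²≤n)))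
                  (*-monoʳ-≤ 2 (*-monoʳ-≤ 3 (a*n≤n*n 0<a a²≤n))) ⟩
    3 * (n * n * n) + 4 * n + 2 * (3 * (n * n)) ≡⟨ regroup (n * n * n) (n * n) n ⟩
    3 * (n * n * n) + (6 * (n * n) + 4 * n)     ≤⟨ +-monoʳ-≤ (3 * (n * n * n)) (7≤n⇒6n²+4n≤n³ 7≤n) ⟩
    3 * (n * n * n) + n * n * n                 ≡⟨ collect (n * n * n) ⟩
    2 * (2 * (n * n * n))                       ∎
    where
    open ≤-Reasoning
    regroup : ∀ m k l → 3 * m + 4 * l + 2 * (3 * k) ≡ 3 * m + (6 * k + 4 * l)
    regroup = solve-∀
    collect : ∀ m → 3 * m + m ≡ 2 * (2 * m)
    collect = solve-∀

  P : ℕ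
  P = 2 * (n * n * n) ∸ 3 * c

  3c≤2n³ : 3 * c ≤ 2 * (n * n * n)
  3c≤2n³ = *-cancelˡ-≤ 2 (≤-trans (m≤n+m (2 * (3 * c)) (3 * (c * c) + 4 * n)) 3c²+4n+6c≤4n³)

  P+3c≡2n³ : P + 3 * c ≡ 2 * (n * n * n)
  P+3c≡2n³ = m∸n+n≡m 3c≤2n³

  3c²+4n≤2P : 3 * (c * c) + 4 * n ≤ 2 * P
  3c²+4n≤2P = +-cancelʳ-≤ (2 * (3 * c)) _ _ (begin
    3 * (c * c) + 4 * n + 2 * (3 * c) ≤⟨ 3c²+4n+6c≤4n³ ⟩
    2 * (2 * (n * n * n))             ≡⟨ cong (2 *_) P+3c≡2n³ ⟨
    2 * (P + 3 * c)                   ≡⟨ *-distribˡ-+ 2 P (3 * c) ⟩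
    2 * P + 2 * (3 * c)               ∎)
    where open ≤-Reasoning

  4n+4a³<3c² : 4 * n + 4 * (a * a * a) < 3 * (c * c)
  4n+4a³<3c² = begin-strict
    4 * n + 4 * (a * a * a) ≤⟨ +-mono-≤ (*-monoʳ-≤ 4 (0<a⇒n≤a*n n 0<a)) (*-monoʳ-≤ 4 (a³≤a*n 0<a a²≤n)) ⟩
    4 * c + 4 * c           ≡⟨ double c ⟩
    8 * c                   <⟨ 7≤n⇒8n<3n² (≤-trans 7≤n (0<a⇒n≤a*n n 0<a)) ⟩
    3 * (c * c)             ∎
    where
    open ≤-Reasoning
    double : ∀ d → 4 * d + 4 * d ≡ 8 * d
    double = solve-∀

  identity : 4 * x ^ 3 + 4 * (a * a * a) ≡ P * P + 3 * (c * c)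
  identity = cube-difference-identity {x} {a} {n} {P} x+a≡n² P+3c≡2n³

  below : P * P + 4 * n < 4 * x ^ 3
  below = +-cancelʳ-< (4 * (a * a * a)) _ _ (begin-strict
    P * P + 4 * n + 4 * (a * a * a)   ≡⟨ +-assoc (P * P) (4 * n) _ ⟩
    P * P + (4 * n + 4 * (a * a * a)) <⟨ +-monoʳ-< (P * P) 4n+4a³<3c² ⟩
    P * P + 3 * (c * c)               ≡⟨ identity ⟨
    4 * x ^ 3 + 4 * (a * a * a)       ∎)
    where open ≤-Reasoning

  above : 4 * x ^ 3 + 4 * n ≤ P * P + 2 * P
  above = begin
    4 * x ^ 3 + 4 * n                   ≤⟨ +-monoˡ-≤ (4 * n) (m≤m+n (4 * x ^ 3) (4 * (a * a * a))) ⟩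
    4 * x ^ 3 + 4 * (a * a * a) + 4 * n ≡⟨ cong (_+ 4 * n) identity ⟩
    P * P + 3 * (c * c) + 4 * n         ≡⟨ +-assoc (P * P) _ (4 * n) ⟩
    P * P + (3 * (c * c) + 4 * n)       ≤⟨ +-monoʳ-≤ (P * P) 3c²+4n≤2P ⟩
    P * P + 2 * P                       ∎
    where open ≤-Reasoning

n²≡n*n : ∀ n → n ^ 2 ≡ n * n
n²≡n*n n = cong (n *_) (*-identityʳ n)

n²±a≤n²+n : ∀ {n a x} → a ≤ n → x ≡ n ^ 2 + a ⊎ x + a ≡ n ^ 2 → x ≤ n * n + n
n²±a≤n²+n {n} {a} {x} a≤n (inj₁ x≡n²+a) = begin
  x         ≡⟨ x≡n²+a ⟩
  n ^ 2 + a ≡⟨ cong (_+ a) (n²≡n*n n) ⟩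
  n * n + a ≤⟨ +-monoʳ-≤ (n * n) a≤n ⟩
  n * n + n ∎
  where open ≤-Reasoning
n²±a≤n²+n {n} {a} {x} a≤n (inj₂ x+a≡n²) = begin
  x         ≤⟨ m≤m+n x a ⟩
  x + a     ≡⟨ x+a≡n² ⟩
  n ^ 2     ≡⟨ n²≡n*n n ⟩
  n * n     ≤⟨ m≤m+n (n * n) n ⟩
  n * n + n ∎
  where open ≤-Reasoning

k²≤n²+n⇒k≤n : ∀ {k n} → k * k ≤ n * n + n → k ≤ n
k²≤n²+n⇒k≤n {k} {n} k²≤n²+n = ≮⇒≥ λ n<k → <⇒≱ (begin-strict
  n * n + n           <⟨ s≤s (+-monoʳ-≤ (n * n) (m≤m+n n (n + 0))) ⟩
  suc (n * n + 2 * n) ≡⟨ suc-square n ⟨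
  suc n * suc n       ≤⟨ *-mono-≤ n<k n<k ⟩
  k * k               ∎) k²≤n²+n
  where open ≤-Reasoning

lemma6 : (n a x : ℕ) → n % 2 ≡ 1 → 0 < a →
    (x ≡ n ^ 2 + a ⊎ x + a ≡ n ^ 2) →
    Hall x → 10 ^ 18 < x →
    n < a * a
lemma6 n a x _ 0<a x≡n²±a (_ , _ , k , ((m , ∣x³-m²∣≡k) , _) , k²<x) 10¹⁸<x with a * a ≤? n
... | no a²≰n = ≰⇒> a²≰n
... | yes a²≤n = contradiction 4x³-near-square (not-near x≡n²±a)
  where
  x≤n²+n : x ≤ n * n + n
  x≤n²+n = n²±a≤n²+n (a≤n 0<a a²≤n) x≡n²±a

  k≤n : k ≤ n
  k≤n = k²≤n²+n⇒k≤n (≤-trans (<⇒≤ k²<x) x≤n²+n)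

  7≤n : 7 ≤ n
  7≤n = ≮⇒≥ λ n<7 → let n≤6 = ≤-pred n<7 in
    <⇒≱ 10¹⁸<x (≤-trans x≤n²+n (≤-trans (+-mono-≤ (*-mono-≤ n≤6 n≤6) n≤6) (≤ᵇ⇒≤ 42 (10 ^ 18) _)))

  4x³-near-square : NearSquare (4 * x ^ 3) (4 * n)
  4x³-near-square = NearSquare-scale 2 {x ^ 3} (m , subst (_≤ n) (sym ∣x³-m²∣≡k) k≤n)

  not-near : x ≡ n ^ 2 + a ⊎ x + a ≡ n ^ 2 → ¬ NearSquare (4 * x ^ 3) (4 * n)
  not-near (inj₁ x≡n²+a) = 4[n²+a]³-not-near-square 7≤n 0<a a²≤n x≡n²+a
  not-near (inj₂ x+a≡n²) = 4[n²-a]³-not-near-square 7≤n 0<a a²≤n (trans x+a≡n² (n²≡n*n n))
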